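{- Let $k$ be a positive integer and let $D$ be a digraph with a partition $\{X,Y\}$ of $V(D)$ such that $D[X]$ is traceable and $Y$ is a stable set of $D$. Then $\pi_k(D)\leq |Y|+\min\{|X|,k\}$.
   Context: Digraphs have no loops and no parallel arcs. Paths are directed paths; the size $|P|$ of a path is its number of vertices. A digraph is traceable if it has a Hamiltonian path. A stable set of $D$ is a stable set of its underlying undirected graph. A path partition of $D$ is a set of vertex-disjoint paths covering $V(D)$; its $k$-norm is $\sum_{P}\min\{|P|,k\}$, and $\pi_k(D)$ is the minimum $k$-norm over all path partitions of $D$. -}

module Defs where

open import Data.Nat using (ℕ; suc; _+_; _⊓_; _≤_)
open import Data.Bool using (Bool; true; false)
open import Data.Fin using (Fin)
open import Data.Fin.Subset using (Subset; _∈_; _∉_; ∁; ∣_∣)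
open import Data.Fin.Subset.Properties using (_∈?_)
open import Data.List using (List; []; _∷_; length; map; concat; filter; allFin)
open import Data.List.Relation.Binary.Permutation.Propositional using (_↭_)
open import Data.List.Relation.Unary.All using (All)
open import Data.Nat.ListAction using (sum)
open import Data.Unit using (⊤)
open import Data.Product using (Σ; _×_; ∃)
open import Relation.Binary.PropositionalEquality using (_≡_)

record Digraph (n : ℕ) : Set where
  field
    arc    : Fin n → Fin n → Bool
    loopless : ∀ v → arc v v ≡ false
open Digraph public

Walk : ∀ {n} → Digraph n → List (Fin n) → Set
Walk D []           = ⊤
Walk D (u ∷ [])     = ⊤
Walk D (u ∷ v ∷ vs) = (arc D u v ≡ true) × Walk D (v ∷ vs)

-- A (directed) path: a nonempty sequence of vertices with consecutive arcs.
-- Distinctness of the vertices is enforced by the covering conditions below.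
IsPath : ∀ {n} → Digraph n → List (Fin n) → Set
IsPath D P = (1 ≤ length P) × Walk D P

elems : ∀ {n} → Subset n → List (Fin n)
elems X = filter (_∈? X) (allFin _)

-- D[X] is traceable: some path of D (hence of D[X]) visits every vertex
-- of X exactly once and no other vertex.
Traceable : ∀ {n} → Digraph n → Subset n → Set
Traceable D X = Σ (List _) λ P → IsPath D P × (P ↭ elems X)

Stable : ∀ {n} → Digraph n → Subset n → Set
Stable D Y = ∀ u v → u ∈ Y → v ∈ Y → arc D u v ≡ false

-- A path partition: a list of paths, vertex-disjoint, covering V(D)
-- (the concatenation of their vertex sequences is a permutation of V(D)).
IsPathPartition : ∀ {n} → Digraph n → List (List (Fin n)) → Set
IsPathPartition {n} D Ps = All (IsPath D) Ps × (concat Ps ↭ allFin n)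

kNorm : ∀ {n} → ℕ → List (List (Fin n)) → ℕ
kNorm k Ps = sum (map (λ P → length P ⊓ k) Ps)

IsPiK : ∀ {n} → Digraph n → ℕ → ℕ → Set
IsPiK D k m =
  (Σ _ λ Ps → IsPathPartition D Ps × kNorm k Ps ≡ m) ×
  (∀ Ps → IsPathPartition D Ps → m ≤ kNorm k Ps)

-- A Hamiltonian path of D[X] together with the vertices of Y as
-- one-vertex paths is a path partition of D; its k-norm is min{|X|,k} + |Y|
-- because k ≥ 1, and π_k(D) is at most the k-norm of any path partition.
module Submission where

open import Defs
open import Data.Nat using (ℕ; zero; suc; _+_; _⊓_; _≤_; _>_; z≤n; s≤s)
open import Data.Nat.Properties using (+-comm; ≤-trans; ≤-reflexive)
open import Data.Bool using (true; false)
open import Data.Fin using (Fin; zero; suc)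
open import Data.Fin.Subset using (Subset; ∁; ∣_∣; inside; outside)
open import Data.Fin.Subset.Properties using (_∈?_)
open import Data.Vec using ([]; _∷_)
open import Data.List using (List; []; _∷_; _++_; [_]; length; map; concat; filter; tabulate; allFin)
open import Data.List.Properties using (length-map; map-++; map-tabulate; concat-map-[_])
open import Data.List.Relation.Binary.Permutation.Propositional using (_↭_; ↭-refl; prep; module PermutationReasoning)
open import Data.List.Relation.Binary.Permutation.Propositional.Properties using (↭-length; shift; ++⁺ʳ; map⁺)
open import Data.List.Relation.Unary.All using (All; []; _∷_)
open import Data.Product using (_,_)
open import Data.Unit using (tt)
open import Function using (_∘_; id)
open import Relation.Nullary using (does)
open import Relation.Binary.PropositionalEquality using (_≡_; refl; cong; cong₂; sym; trans; module ≡-Reasoning)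

filter-∈?-tabulate-suc : ∀ {m n} b (X : Subset n) (g : Fin m → Fin n) →
  filter (_∈? (b ∷ X)) (tabulate (suc ∘ g)) ≡ map suc (filter (_∈? X) (tabulate g))
filter-∈?-tabulate-suc {zero}  b X g = refl
filter-∈?-tabulate-suc {suc m} b X g with does (g zero ∈? X)
... | true  = cong (suc (g zero) ∷_) (filter-∈?-tabulate-suc b X (g ∘ suc))
... | false = filter-∈?-tabulate-suc b X (g ∘ suc)

elems-inside : ∀ {n} (X : Subset n) → elems (inside ∷ X) ≡ zero ∷ map suc (elems X)
elems-inside X = cong (zero ∷_) (filter-∈?-tabulate-suc inside X id)

elems-outside : ∀ {n} (X : Subset n) → elems (outside ∷ X) ≡ map suc (elems X)
elems-outside X = filter-∈?-tabulate-suc outside X id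

length-elems : ∀ {n} (X : Subset n) → length (elems X) ≡ ∣ X ∣
length-elems []            = refl
length-elems (inside ∷ X)  =
  trans (cong length (elems-inside X)) (cong suc (trans (length-map suc (elems X)) (length-elems X)))
length-elems (outside ∷ X) =
  trans (cong length (elems-outside X)) (trans (length-map suc (elems X)) (length-elems X))

elems-++-elems-∁ : ∀ {n} (X : Subset n) → elems X ++ elems (∁ X) ↭ allFin n
elems-++-elems-∁ []        = ↭-refl
elems-++-elems-∁ {suc n} (b ∷ X) = begin
    elems (b ∷ X) ++ elems (∁ (b ∷ X))     ↭⟨ split b ⟩
    zero ∷ map suc (elems X ++ elems (∁ X)) ↭⟨ prep zero (map⁺ suc (elems-++-elems-∁ X)) ⟩
    zero ∷ map suc (allFin n)               ≡⟨ cong (zero ∷_) (map-tabulate id suc) ⟩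
    allFin (suc n)                          ∎
  where
  open PermutationReasoning
  split : ∀ b → elems (b ∷ X) ++ elems (∁ (b ∷ X)) ↭ zero ∷ map suc (elems X ++ elems (∁ X))
  split inside = begin
    elems (inside ∷ X) ++ elems (outside ∷ ∁ X)      ≡⟨ cong₂ _++_ (elems-inside X) (elems-outside (∁ X)) ⟩
    zero ∷ map suc (elems X) ++ map suc (elems (∁ X)) ≡⟨ cong (zero ∷_) (sym (map-++ suc (elems X) (elems (∁ X)))) ⟩
    zero ∷ map suc (elems X ++ elems (∁ X))           ∎
  split outside = begin
    elems (outside ∷ X) ++ elems (inside ∷ ∁ X)       ≡⟨ cong₂ _++_ (elems-outside X) (elems-inside (∁ X)) ⟩
    map suc (elems X) ++ zero ∷ map suc (elems (∁ X)) ↭⟨ shift zero (map suc (elems X)) (map suc (elems (∁ X))) ⟩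
    zero ∷ map suc (elems X) ++ map suc (elems (∁ X)) ≡⟨ cong (zero ∷_) (sym (map-++ suc (elems X) (elems (∁ X)))) ⟩
    zero ∷ map suc (elems X ++ elems (∁ X))           ∎

singletons-isPath : ∀ {n} (D : Digraph n) (ys : List (Fin n)) → All (IsPath D) (map [_] ys)
singletons-isPath D []       = []
singletons-isPath D (y ∷ ys) = (s≤s z≤n , tt) ∷ singletons-isPath D ys

kNorm-singletons : ∀ {n} k (ys : List (Fin n)) → kNorm (suc k) (map [_] ys) ≡ length ys
kNorm-singletons k []       = refl
kNorm-singletons k (y ∷ ys) = cong suc (kNorm-singletons k ys)

module _ {n} (D : Digraph n) (X : Subset n) {P : List (Fin n)} (P↭X : P ↭ elems X) where

  pathWithSingletons : List (List (Fin n))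
  pathWithSingletons = P ∷ map [_] (elems (∁ X))

  pathWithSingletons-isPathPartition : IsPath D P → IsPathPartition D pathWithSingletons
  pathWithSingletons-isPathPartition P-path = P-path ∷ singletons-isPath D (elems (∁ X)) , cover
    where
    open PermutationReasoning
    cover : concat pathWithSingletons ↭ allFin n
    cover = begin
      P ++ concat (map [_] (elems (∁ X))) ≡⟨ cong (P ++_) (concat-map-[_] (elems (∁ X))) ⟩
      P ++ elems (∁ X)                    ↭⟨ ++⁺ʳ (elems (∁ X)) P↭X ⟩
      elems X ++ elems (∁ X)              ↭⟨ elems-++-elems-∁ X ⟩
      allFin n                            ∎

  kNorm-pathWithSingletons : ∀ k → kNorm (suc k) pathWithSingletons ≡ ∣ ∁ X ∣ + ∣ X ∣ ⊓ suc k
  kNorm-pathWithSingletons k = begin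
    length P ⊓ suc k + kNorm (suc k) (map [_] (elems (∁ X))) ≡⟨ cong (length P ⊓ suc k +_) (kNorm-singletons k (elems (∁ X))) ⟩
    length P ⊓ suc k + length (elems (∁ X))                  ≡⟨ cong (λ l → l ⊓ suc k + length (elems (∁ X))) (trans (↭-length P↭X) (length-elems X)) ⟩
    ∣ X ∣ ⊓ suc k + length (elems (∁ X))                     ≡⟨ cong (∣ X ∣ ⊓ suc k +_) (length-elems (∁ X)) ⟩
    ∣ X ∣ ⊓ suc k + ∣ ∁ X ∣                                  ≡⟨ +-comm (∣ X ∣ ⊓ suc k) ∣ ∁ X ∣ ⟩
    ∣ ∁ X ∣ + ∣ X ∣ ⊓ suc k                                  ∎
    where open ≡-Reasoning

lemma1 : (k : ℕ) → k > 0 → (n : ℕ) → (D : Digraph n) → (X : Subset n) →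
    Traceable D X → Stable D (∁ X) →
    (m : ℕ) → IsPiK D k m → m ≤ ∣ ∁ X ∣ + (∣ X ∣ ⊓ k)
lemma1 zero    ()
lemma1 (suc k) _ n D X (P , P-path , P↭X) _ m (_ , minimal) =
  ≤-trans (minimal (pathWithSingletons D X P↭X) (pathWithSingletons-isPathPartition D X P↭X P-path))
          (≤-reflexive (kNorm-pathWithSingletons D X P↭X k))
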